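{- Let $G$ be a finite connected graph and $P_r$ the path with vertex set $\{1,\ldots,r\}$. Let $S$ be an isometric path cover (respectively, isometric path partition) of $P_r\,\square\, G$. If there exists $j_0$ with $1\leq j_0\leq r$ such that no path of $S$ contains any $G^{j_0}$-edge, then $|S|\geq |V(G)|$.
   Context: $P_r\,\square\, G$ is the Cartesian product with vertex set $\{(j,v): 1\le j\le r,\ v\in V(G)\}$. For each $j$, $G^j$ denotes the subgraph induced by $\{(j,v): v\in V(G)\}$ (a copy of $G$), and a $G^j$-edge is an edge of $G^j$. A path is isometric if its length equals the distance between its endpoints; single vertices count as paths. An isometric path cover is a set of isometric paths covering all vertices; an isometric path partition is one in which each vertex lies on exactly one path. -}

module Defs where

open import Data.Nat using (ℕ; suc; _≤_)
open import Data.Fin using (Fin; toℕ)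
open import Data.Product using (_×_; _,_; Σ; ∃; ∃-syntax)
open import Data.Sum using (_⊎_)
open import Data.List using (List; []; _∷_; _++_; length; head; last)
open import Data.List.Relation.Unary.Linked using (Linked)
open import Data.List.Relation.Unary.Unique.Propositional using (Unique)
open import Data.List.Membership.Propositional using (_∈_)
open import Data.Empty using (⊥)
open import Relation.Nullary using (¬_)
open import Relation.Binary.PropositionalEquality using (_≡_; _≢_)

record Graph (n : ℕ) : Set₁ where
  field
    Adj   : Fin n → Fin n → Set
    sym   : ∀ {u v} → Adj u v → Adj v u
    irref : ∀ {u} → ¬ Adj u u
open Graph public

IsWalk : {V : Set} → (V → V → Set) → List V → Set
IsWalk E p = Linked E p

Connected : ∀ {n} → Graph n → Set
Connected {n} G = ∀ (u v : Fin n) → ∃[ w ] (IsWalk (Adj G) w × head w ≡ Data.Maybe.just u × last w ≡ Data.Maybe.just v)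
  where import Data.Maybe

-- An isometric path: a nonempty list of distinct vertices, consecutive ones adjacent,
-- whose length (number of edges = number of vertices − 1) is the distance between
-- its endpoints, i.e. no walk between the same endpoints has fewer vertices.
IsIsometricPath : {V : Set} → (V → V → Set) → List V → Set
IsIsometricPath E p =
  p ≢ [] × IsWalk E p × Unique p ×
  (∀ (q : List _) → IsWalk E q → head q ≡ head p → last q ≡ last p → length p ≤ length q)

-- Cartesian product P_r □ G; layers are indexed by Fin r (layer j ↔ j+1 in the paper).
PathAdj : ∀ {r} → Fin r → Fin r → Set
PathAdj i j = toℕ j ≡ suc (toℕ i) ⊎ toℕ i ≡ suc (toℕ j)

ProdAdj : ∀ {r n} → Graph n → (Fin r × Fin n) → (Fin r × Fin n) → Set
ProdAdj G (i , u) (j , v) = (i ≡ j × Adj G u v) ⊎ (PathAdj i j × u ≡ v)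

-- Families of paths S = {S₀,…,S_{k-1}} in P_r □ G; |S| = k.
Family : ℕ → ℕ → ℕ → Set
Family r n k = Fin k → List (Fin r × Fin n)

IsIsometricPathCover : ∀ {r n k} → Graph n → Family r n k → Set
IsIsometricPathCover {r} {n} {k} G S =
  (∀ i → IsIsometricPath (ProdAdj {r} G) (S i)) ×
  (∀ (x : Fin r × Fin n) → ∃[ i ] (x ∈ S i))

IsIsometricPathPartition : ∀ {r n k} → Graph n → Family r n k → Set
IsIsometricPathPartition {r} {n} {k} G S =
  (∀ i → IsIsometricPath (ProdAdj {r} G) (S i)) ×
  (∀ (x : Fin r × Fin n) → ∃[ i ] (x ∈ S i × (∀ i' → x ∈ S i' → i' ≡ i)))

EdgeOn : {V : Set} → V → V → List V → Set
EdgeOn {V} x y p = ∃[ xs ] ∃[ ys ] (p ≡ xs ++ x ∷ y ∷ ys ⊎ p ≡ xs ++ y ∷ x ∷ ys)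

NoLayerEdge : ∀ {r n k} → Graph n → Family r n k → Fin r → Set
NoLayerEdge {r} {n} {k} G S j =
  ∀ (i : Fin k) (u v : Fin n) → Adj G u v → ¬ EdgeOn (j , u) (j , v) (S i)

-- An isometric path of P_r □ G that uses no G^{j₀}-edge meets the layer G^{j₀}
-- at most once: it could only leave a vertex (j₀ , u) along a P_r-edge, and a
-- segment returning to the layer can be projected onto G^{j₀}, merging the two
-- ends of every P_r-edge; the projection is a strictly shorter walk between the
-- same endpoints. So sending u to a path of S covering (j₀ , u) is injective.
module Submission where

open import Defs hiding (sym)
open import Level using (Level)
open import Data.Nat using (ℕ; _+_; _≤_; _<_; s≤s)
open import Data.Nat.Properties using (≤-reflexive; ≤-trans; <-irrefl; +-cancelˡ-≤; +-cancelʳ-≤)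
open import Data.Fin using (Fin; _≟_)
open import Data.Fin.Properties using (injective⇒≤)
open import Data.Product using (_×_; ∃-syntax; _,_; proj₁; proj₂)
open import Data.Sum using (inj₁; inj₂)
open import Data.List using (List; []; _∷_; _++_; length; head; last; map; derun; [_])
open import Data.List.Properties
  using (++-assoc; ++-identityʳ; length-++; length-map; head-map; last-map; length-derun; derun-reject)
open import Data.List.Relation.Unary.Linked using (Linked; []; [-]; _∷_; head′; tail; _∷′_)
import Data.List.Relation.Unary.Linked as Linked
open import Data.List.Relation.Unary.Linked.Properties using (map⁺; ++⁺)
open import Data.List.Membership.Propositional using (_∈_)
open import Data.List.Membership.Propositional.Properties using (∈-∃++; ∈-++⁻)
open import Data.List.Relation.Unary.Any using (here; there)
open import Data.Maybe using (just; nothing)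
import Data.Maybe as Maybe
import Data.Maybe.Properties as Maybe
open import Data.Maybe.Relation.Binary.Connected using (nothing-just; nothing)
import Data.Maybe.Relation.Binary.Connected as Maybe
open import Data.Empty using (⊥; ⊥-elim)
open import Function using (_∘_)
open import Relation.Nullary using (¬_; yes; no)
open import Relation.Binary.Core using (Rel)
open import Relation.Binary.Definitions using (DecidableEquality)
open import Relation.Binary.Construct.Closure.Reflexive using (ReflClosure)
import Relation.Binary.Construct.Closure.Reflexive as ReflClosure
open import Relation.Binary.PropositionalEquality using (_≡_; _≢_; refl; sym; trans; cong; subst; subst₂; module ≡-Reasoning)

private
  variable
    a ℓ : Level

module _ {A : Set a} where

  head-++ˡ : ∀ {xs xs' : List A} ys → head xs ≡ head xs' → head (xs ++ ys) ≡ head (xs' ++ ys)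
  head-++ˡ {xs = []}    {[]}    ys _  = refl
  head-++ˡ {xs = _ ∷ _} {_ ∷ _} ys eq = eq

  head-++ʳ : ∀ (xs : List A) {ys ys'} → head ys ≡ head ys' → head (xs ++ ys) ≡ head (xs ++ ys')
  head-++ʳ []      eq = eq
  head-++ʳ (_ ∷ _) eq = refl

  last-++-∷ : ∀ (xs : List A) y ys → last (xs ++ y ∷ ys) ≡ last (y ∷ ys)
  last-++-∷ []           y ys = refl
  last-++-∷ (_ ∷ [])     y ys = refl
  last-++-∷ (_ ∷ x ∷ xs) y ys = last-++-∷ (x ∷ xs) y ys

  last-∷ : ∀ (x : A) {y} ys → head ys ≡ just y → last (x ∷ ys) ≡ last ys
  last-∷ x (_ ∷ _) _ = refl

  last-∷-nonempty : ∀ (x : A) xs → last (x ∷ xs) ≢ nothing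
  last-∷-nonempty x []       ()
  last-∷-nonempty x (y ∷ xs) = last-∷-nonempty y xs

  last-++ˡ : ∀ {xs xs' : List A} ys → last xs ≡ last xs' → last (xs ++ ys) ≡ last (xs' ++ ys)
  last-++ˡ {xs = xs} {xs'} [] eq
    rewrite ++-identityʳ xs | ++-identityʳ xs' = eq
  last-++ˡ {xs = xs} {xs'} (y ∷ ys) _
    rewrite last-++-∷ xs y ys | last-++-∷ xs' y ys = refl

  last-++ʳ : ∀ (xs : List A) {ys ys'} → last ys ≡ last ys' → last (xs ++ ys) ≡ last (xs ++ ys')
  last-++ʳ xs {[]}    {[]}      _  = refl
  last-++ʳ xs {[]}    {y' ∷ ys'} eq = ⊥-elim (last-∷-nonempty y' ys' (sym eq))
  last-++ʳ xs {y ∷ ys} {[]}      eq = ⊥-elim (last-∷-nonempty y ys eq)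
  last-++ʳ xs {y ∷ ys} {y' ∷ ys'} eq
    rewrite last-++-∷ xs y ys | last-++-∷ xs y' ys' = eq

  length-++-++ : ∀ (xs ys zs : List A) → length (xs ++ ys ++ zs) ≡ length xs + (length ys + length zs)
  length-++-++ xs ys zs = trans (length-++ xs) (cong (length xs +_) (length-++ ys))

module _ {A : Set a} {R : Rel A ℓ} where

  Linked-++⁻ : ∀ xs {ys} → Linked R (xs ++ ys) →
               Linked R xs × Maybe.Connected R (last xs) (head ys) × Linked R ys
  Linked-++⁻ [] {[]}    l = [] , nothing , l
  Linked-++⁻ [] {_ ∷ _} l = [] , nothing-just , l
  Linked-++⁻ (x ∷ []) l = [-] , head′ l , tail l
  Linked-++⁻ (x ∷ y ∷ xs) (r ∷ l) with Linked-++⁻ (y ∷ xs) l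
  ... | lxs , c , lys = r ∷ lxs , c , lys

  Linked-infix : ∀ xs ys {zs} → Linked R (xs ++ ys ++ zs) → Linked R ys
  Linked-infix xs ys l = proj₁ (Linked-++⁻ ys (proj₂ (proj₂ (Linked-++⁻ xs l))))

  Linked-replace-infix : ∀ xs {ys ys'} zs → Linked R (xs ++ ys ++ zs) → Linked R ys' →
                         head ys' ≡ head ys → last ys' ≡ last ys → Linked R (xs ++ ys' ++ zs)
  Linked-replace-infix xs {ys} zs l l' h t with Linked-++⁻ xs l
  ... | lxs , c₁ , lyzs with Linked-++⁻ ys lyzs
  ... | _ , c₂ , lzs =
    ++⁺ lxs (subst (Maybe.Connected R (last xs)) (head-++ˡ zs (sym h)) c₁)
        (++⁺ l' (subst (λ m → Maybe.Connected R m (head zs)) (sym t) c₂) lzs)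

module _ {A : Set} {R : A → A → Set} where

  isometric-infix-minimal : ∀ xs ys zs {ys'} → IsIsometricPath R (xs ++ ys ++ zs) →
                            IsWalk R ys' → head ys' ≡ head ys → last ys' ≡ last ys →
                            length ys ≤ length ys'
  isometric-infix-minimal xs ys zs {ys'} (_ , walk , _ , shortest) walk' h t =
    +-cancelʳ-≤ (length zs) _ _ (+-cancelˡ-≤ (length xs) _ _
      (subst₂ _≤_ (length-++-++ xs ys zs) (length-++-++ xs ys' zs) longer))
    where
    longer : length (xs ++ ys ++ zs) ≤ length (xs ++ ys' ++ zs)
    longer = shortest (xs ++ ys' ++ zs) (Linked-replace-infix xs zs walk walk' h t)
               (head-++ʳ xs (head-++ˡ {xs = ys'} {ys} zs h)) (last-++ʳ xs (last-++ˡ {xs = ys'} {ys} zs t))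

module _ {A : Set a} (_≟ₐ_ : DecidableEquality A) where

  head-derun : ∀ xs → head (derun _≟ₐ_ xs) ≡ head xs
  head-derun []           = refl
  head-derun (x ∷ [])     = refl
  head-derun (x ∷ y ∷ xs) with x ≟ₐ y | head-derun (y ∷ xs)
  ... | yes x≡y | ih = trans ih (cong just (sym x≡y))
  ... | no _    | _  = refl

  last-derun : ∀ xs → last (derun _≟ₐ_ xs) ≡ last xs
  last-derun []           = refl
  last-derun (x ∷ [])     = refl
  last-derun (x ∷ y ∷ xs) with x ≟ₐ y | last-derun (y ∷ xs)
  ... | yes _ | ih = ih
  ... | no _  | ih = trans (last-∷ x _ (head-derun (y ∷ xs))) ih

  derun-Linked : ∀ {R : Rel A ℓ} {xs} → Linked (ReflClosure R) xs → Linked R (derun _≟ₐ_ xs)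
  derun-Linked []  = []
  derun-Linked [-] = [-]
  derun-Linked {R = R} {x ∷ y ∷ xs} (r ∷ l) with x ≟ₐ y | r
  ... | yes _    | _                = derun-Linked l
  ... | no x≢y   | ReflClosure.refl = ⊥-elim (x≢y refl)
  ... | no _     | ReflClosure.[ Rxy ] =
    subst (Maybe.Connected R (just x)) (sym (head-derun (y ∷ xs))) (Maybe.just Rxy) ∷′ derun-Linked l

module _ {n : ℕ} (G : Graph n) {r : ℕ} where

  Vertex : Set
  Vertex = Fin r × Fin n

  NoLayerEdgeOn : Fin r → List Vertex → Set
  NoLayerEdgeOn j p = ∀ u v → Adj G u v → ¬ EdgeOn (j , u) (j , v) p

  toLayer : Fin r → List Vertex → List Vertex
  toLayer j = map (j ,_) ∘ derun _≟_ ∘ map proj₂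

  projectEdge : ∀ {x y : Vertex} → ProdAdj G x y → ReflClosure (Adj G) (proj₂ x) (proj₂ y)
  projectEdge (inj₁ (_ , adj))  = ReflClosure.[ adj ]
  projectEdge (inj₂ (_ , refl)) = ReflClosure.refl

  toLayer-walk : ∀ j {ys} → IsWalk (ProdAdj G) ys → IsWalk (ProdAdj G) (toLayer j ys)
  toLayer-walk j walk =
    map⁺ (Linked.map (λ adj → inj₁ (refl , adj)) (derun-Linked _≟_ (map⁺ (Linked.map projectEdge walk))))

  head-toLayer : ∀ j ys → head (toLayer j ys) ≡ Maybe.map ((j ,_) ∘ proj₂) (head ys)
  head-toLayer j ys = begin
    head (toLayer j ys)                                     ≡⟨ head-map (derun _≟_ (map proj₂ ys)) ⟩
    Maybe.map (j ,_) (head (derun _≟_ (map proj₂ ys)))      ≡⟨ cong (Maybe.map (j ,_)) (head-derun _≟_ (map proj₂ ys)) ⟩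
    Maybe.map (j ,_) (head (map proj₂ ys))                  ≡⟨ cong (Maybe.map (j ,_)) (head-map ys) ⟩
    Maybe.map (j ,_) (Maybe.map proj₂ (head ys))            ≡⟨ sym (Maybe.map-∘ (head ys)) ⟩
    Maybe.map ((j ,_) ∘ proj₂) (head ys)                    ∎
    where open ≡-Reasoning

  last-toLayer : ∀ j ys → last (toLayer j ys) ≡ Maybe.map ((j ,_) ∘ proj₂) (last ys)
  last-toLayer j ys = begin
    last (toLayer j ys)                                     ≡⟨ last-map (j ,_) (derun _≟_ (map proj₂ ys)) ⟩
    Maybe.map (j ,_) (last (derun _≟_ (map proj₂ ys)))      ≡⟨ cong (Maybe.map (j ,_)) (last-derun _≟_ (map proj₂ ys)) ⟩
    Maybe.map (j ,_) (last (map proj₂ ys))                  ≡⟨ cong (Maybe.map (j ,_)) (last-map proj₂ ys) ⟩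
    Maybe.map (j ,_) (Maybe.map proj₂ (last ys))            ≡⟨ sym (Maybe.map-∘ (last ys)) ⟩
    Maybe.map ((j ,_) ∘ proj₂) (last ys)                    ∎
    where open ≡-Reasoning

  toLayer-shortens-vertical : ∀ j i i' u ys →
    length (toLayer j ((i , u) ∷ (i' , u) ∷ ys)) < length ((i , u) ∷ (i' , u) ∷ ys)
  toLayer-shortens-vertical j i i' u ys
    rewrite length-map (j ,_) (derun _≟_ (u ∷ u ∷ map proj₂ ys))
          | derun-reject _≟_ (map proj₂ ys) (refl {x = u}) =
    s≤s (≤-trans (length-derun _≟_ (u ∷ map proj₂ ys)) (s≤s (≤-reflexive (length-map proj₂ ys))))

  leave-and-return-impossible : ∀ j p xs u ws zs {v} → p ≡ xs ++ ((j , u) ∷ ws) ++ zs →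
    IsIsometricPath (ProdAdj G) p → NoLayerEdgeOn j p → last ws ≡ just (j , v) → ⊥
  leave-and-return-impossible j _ xs u (y ∷ ys) zs refl isometric noEdge returns =
    leave (Linked.head segment-walk)
    where
    segment-walk : IsWalk (ProdAdj G) ((j , u) ∷ y ∷ ys)
    segment-walk = Linked-infix xs ((j , u) ∷ y ∷ ys) (proj₁ (proj₂ isometric))
    leave : ProdAdj G (j , u) y → ⊥
    leave (inj₁ (refl , adj)) = noEdge u (proj₂ y) adj (xs , ys ++ zs , inj₁ refl)
    leave (inj₂ (_ , refl)) =
      <-irrefl refl (≤-trans (toLayer-shortens-vertical j j (proj₁ y) u ys)
        (isometric-infix-minimal xs ((j , u) ∷ y ∷ ys) zs isometric
          (toLayer-walk j segment-walk)
          (head-toLayer j ((j , u) ∷ y ∷ ys))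
          (trans (last-toLayer j ((j , u) ∷ y ∷ ys))
            (trans (cong (Maybe.map ((j ,_) ∘ proj₂)) returns) (sym returns)))))

  isometric-path-meets-layer-once : ∀ j {p u v} → IsIsometricPath (ProdAdj G) p → NoLayerEdgeOn j p →
                                    (j , u) ∈ p → (j , v) ∈ p → u ≡ v
  isometric-path-meets-layer-once j {u = u} {v} isometric noEdge u∈p v∈p with ∈-∃++ u∈p
  ... | xs , zs , refl with ∈-++⁻ xs v∈p
  ... | inj₂ (here refl) = refl
  ... | inj₂ (there v∈zs) with ∈-∃++ v∈zs
  ...   | ys , zs' , refl =
    ⊥-elim (leave-and-return-impossible j _ xs u (ys ++ [ (j , v) ]) zs'
      (cong (λ t → xs ++ (j , u) ∷ t) (sym (++-assoc ys [ (j , v) ] zs')))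
      isometric noEdge (last-++-∷ ys (j , v) []))
  isometric-path-meets-layer-once j {u = u} {v} isometric noEdge u∈p v∈p
    | xs , zs , refl | inj₁ v∈xs with ∈-∃++ v∈xs
  ...   | xs' , ys , refl =
    ⊥-elim (leave-and-return-impossible j _ xs' v (ys ++ [ (j , u) ]) zs
      (trans (++-assoc xs' ((j , v) ∷ ys) ((j , u) ∷ zs))
        (cong (λ t → xs' ++ (j , v) ∷ t) (sym (++-assoc ys [ (j , u) ] zs))))
      isometric noEdge (last-++-∷ ys (j , u) []))

module _ {n r k : ℕ} (G : Graph n) {S : Family r n k} where

  partition⇒cover : IsIsometricPathPartition G S → IsIsometricPathCover G S
  partition⇒cover (isometric , covers) = isometric , λ x → proj₁ (covers x) , proj₁ (proj₂ (covers x))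

  cover-size-≥ : IsIsometricPathCover G S → ∃[ j₀ ] NoLayerEdge G S j₀ → n ≤ k
  cover-size-≥ (isometric , covers) (j₀ , noEdge) = injective⇒≤ {f = pathThrough} pathThrough-injective
    where
    pathThrough : Fin n → Fin k
    pathThrough u = proj₁ (covers (j₀ , u))
    pathThrough-injective : ∀ {u v} → pathThrough u ≡ pathThrough v → u ≡ v
    pathThrough-injective {u} {v} eq =
      isometric-path-meets-layer-once G j₀ (isometric (pathThrough u)) (noEdge (pathThrough u))
        (proj₂ (covers (j₀ , u))) (subst (λ i → (j₀ , v) ∈ S i) (sym eq) (proj₂ (covers (j₀ , v))))

lemma3 : ∀ {n} (G : Graph n) → Connected G → (r k : ℕ) (S : Family r n k) →
    ((IsIsometricPathCover G S → ∃[ j₀ ] NoLayerEdge G S j₀ → n ≤ k) ×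
    (IsIsometricPathPartition G S → ∃[ j₀ ] NoLayerEdge G S j₀ → n ≤ k))
lemma3 G _ r k S = cover-size-≥ G , cover-size-≥ G ∘ partition⇒cover G
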